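{- Let $s$ be a positive integer and let $(x_n(q))_{n\geq 0}$ be a strongly $q$-log-convex sequence of real polynomials. Then the sequence $\big(x_{k}(q)+x_{k+1}(q)+\cdots+x_{k+s}(q)\big)_{k\geq 0}$ is strongly $q$-log-convex.
   Context: For real polynomials $F(q),G(q)$, write $F(q)\geq_q G(q)$ if $F(q)-G(q)$ has only nonnegative coefficients. A sequence of polynomials $(F_n(q))_{n\geq 0}$ is strongly $q$-log-convex if $F_{n}(q)F_{m}(q)\leq_{q} F_{n-1}(q)F_{m+1}(q)$ for all $m\geq n\geq 1$. -}

module Defs where

open import Level using (Level; _⊔_)
open import Data.Nat using (ℕ; zero; suc; _∸_; _<_)
open import Relation.Binary.Core using (Rel)
open import Relation.Binary.Structures using (IsTotalOrder)
open import Algebra.Bundles using (CommutativeRing)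

record OrderedCommutativeRing (c ℓ₁ ℓ₂ : Level) : Set (Level.suc (c ⊔ ℓ₁ ⊔ ℓ₂)) where
  field
    commutativeRing : CommutativeRing c ℓ₁
  open CommutativeRing commutativeRing public
  field
    _≤_          : Rel Carrier ℓ₂
    isTotalOrder : IsTotalOrder _≈_ _≤_
    +-monoʳ-≤    : ∀ {a b} c → a ≤ b → (a + c) ≤ (b + c)
    *-nonneg     : ∀ {a b} → 0# ≤ a → 0# ≤ b → 0# ≤ (a * b)

module PolyDefs {c ℓ₁ ℓ₂} (R : OrderedCommutativeRing c ℓ₁ ℓ₂) where
  open OrderedCommutativeRing R hiding (zero)

  -- a polynomial in q over R, given by its coefficient sequence
  -- (coeff i is the coefficient of q^i) together with a degree bound
  record Poly : Set (c ⊔ ℓ₁) where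
    field
      coeff  : ℕ → Carrier
      bound  : ℕ
      vanish : ∀ i → bound < i → coeff i ≈ 0#
  open Poly public

  sumUpTo : (ℕ → Carrier) → ℕ → Carrier
  sumUpTo f zero    = f zero
  sumUpTo f (suc k) = sumUpTo f k + f (suc k)

  mulC : (ℕ → Carrier) → (ℕ → Carrier) → ℕ → Carrier
  mulC F G k = sumUpTo (λ i → F i * G (k ∸ i)) k

  _≤q_ : (ℕ → Carrier) → (ℕ → Carrier) → Set ℓ₂
  F ≤q G = ∀ k → 0# ≤ (G k - F k)

  -- strongly q-log-convex: F_n F_m ≤_q F_{n-1} F_{m+1} for all m ≥ n ≥ 1
  -- (n written as suc n)
  StronglyQLogConvex : (ℕ → ℕ → Carrier) → Set ℓ₂
  StronglyQLogConvex F =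
    ∀ n m → suc n Data.Nat.≤ m → mulC (F (suc n)) (F m) ≤q mulC (F n) (F (suc m))

  windowSum : (ℕ → Poly) → ℕ → ℕ → ℕ → Carrier
  windowSum x s k j = sumUpTo (λ i → coeff (x (k Data.Nat.+ i)) j) s

-- Everything is compared coefficientwise, so fix a degree k. Iterating strong
-- q-log-convexity gives x_a x_b ≤_q x_c x_d whenever c ≤ a, c ≤ b and
-- a + b = c + d. With W_a = x_{a+1} + ⋯ + x_{a+s} the window sums are
-- Y_a = x_a + W_a and Y_{a+1} = W_a + x_{a+s+1}. Expanding Y_{n+1} Y_m and
-- Y_n Y_{m+1} bilinearly, both contain W_n W_m, and each of the three remaining
-- terms of the former is dominated, summand by summand, by one of the latter.
module Submission where

open import Defs
open import Level using (Level)
open import Data.Nat using (ℕ; _≤_)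
open import Data.Nat using (zero; suc; s≤s; _∸_) renaming (_+_ to _+ℕ_)
import Data.Nat.Properties as ℕ
open import Data.Nat.Tactic.RingSolver using (solve-∀)
open import Data.Sum using (inj₁; inj₂)
open import Relation.Binary.Bundles using (TotalOrder; Poset)
open import Relation.Binary.PropositionalEquality as ≡ using (_≡_)
import Algebra.Properties.CommutativeSemigroup as CommutativeSemigroupProperties
import Relation.Binary.Reasoning.PartialOrder as PartialOrderReasoning

[1+n+i]+m≡n+[1+m+i] : ∀ n m i → (suc n +ℕ i) +ℕ m ≡ n +ℕ (suc m +ℕ i)
[1+n+i]+m≡n+[1+m+i] = solve-∀

[a+b]+[c+d]≡[a+d]+[c+b] : ∀ a b c d → (a +ℕ b) +ℕ (c +ℕ d) ≡ (a +ℕ d) +ℕ (c +ℕ b)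
[a+b]+[c+d]≡[a+d]+[c+b] = solve-∀

module _ {ℓ ℓ₁ ℓ₂ : Level} (R : OrderedCommutativeRing ℓ ℓ₁ ℓ₂) where
  open OrderedCommutativeRing R hiding (zero) renaming (_≤_ to infix 4 _≤ᵣ_)
  open PolyDefs R

  poset : Poset ℓ ℓ₁ ℓ₂
  poset = TotalOrder.poset (record { isTotalOrder = isTotalOrder })

  open Poset poset using () renaming (refl to ≤ᵣ-refl)
  open PartialOrderReasoning poset
  open CommutativeSemigroupProperties +-commutativeSemigroup using (interchange)

  +-mono-≤ᵣ : ∀ {a b d e} → a ≤ᵣ b → d ≤ᵣ e → a + d ≤ᵣ b + e
  +-mono-≤ᵣ {a} {b} {d} {e} a≤b d≤e = begin
    a + d  ≤⟨ +-monoʳ-≤ d a≤b ⟩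
    b + d  ≈⟨ +-comm b d ⟩
    d + b  ≤⟨ +-monoʳ-≤ b d≤e ⟩
    e + b  ≈⟨ +-comm e b ⟩
    b + e  ∎

  x≤y⇒0≤y-x : ∀ {a b} → a ≤ᵣ b → 0# ≤ᵣ b - a
  x≤y⇒0≤y-x {a} {b} a≤b = begin
    0#     ≈⟨ -‿inverseʳ a ⟨
    a - a  ≤⟨ +-monoʳ-≤ (- a) a≤b ⟩
    b - a  ∎

  0≤y-x⇒x≤y : ∀ {a b} → 0# ≤ᵣ b - a → a ≤ᵣ b
  0≤y-x⇒x≤y {a} {b} 0≤b-a = begin
    a              ≈⟨ +-identityˡ a ⟨
    0# + a         ≤⟨ +-monoʳ-≤ a 0≤b-a ⟩
    (b - a) + a    ≈⟨ +-assoc b (- a) a ⟩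
    b + (- a + a)  ≈⟨ +-congˡ (-‿inverseˡ a) ⟩
    b + 0#         ≈⟨ +-identityʳ b ⟩
    b              ∎

  sumUpTo-cong : ∀ {f g : ℕ → Carrier} k → (∀ i → i ≤ k → f i ≈ g i) →
                 sumUpTo f k ≈ sumUpTo g k
  sumUpTo-cong zero    f≈g = f≈g 0 ℕ.≤-refl
  sumUpTo-cong (suc k) f≈g =
    +-cong (sumUpTo-cong k (λ i i≤k → f≈g i (ℕ.m≤n⇒m≤1+n i≤k))) (f≈g (suc k) ℕ.≤-refl)

  sumUpTo-mono-≤ : ∀ {f g : ℕ → Carrier} k → (∀ i → i ≤ k → f i ≤ᵣ g i) →
                   sumUpTo f k ≤ᵣ sumUpTo g k
  sumUpTo-mono-≤ zero    f≤g = f≤g 0 ℕ.≤-refl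
  sumUpTo-mono-≤ (suc k) f≤g =
    +-mono-≤ᵣ (sumUpTo-mono-≤ k (λ i i≤k → f≤g i (ℕ.m≤n⇒m≤1+n i≤k))) (f≤g (suc k) ℕ.≤-refl)

  sumUpTo-+ : ∀ (f g : ℕ → Carrier) k →
              sumUpTo (λ i → f i + g i) k ≈ sumUpTo f k + sumUpTo g k
  sumUpTo-+ f g zero    = refl
  sumUpTo-+ f g (suc k) = trans (+-congʳ (sumUpTo-+ f g k)) (interchange _ _ _ _)

  sumUpTo-suc : ∀ (f : ℕ → Carrier) k →
                sumUpTo f (suc k) ≈ f 0 + sumUpTo (λ i → f (suc i)) k
  sumUpTo-suc f zero    = refl
  sumUpTo-suc f (suc k) = trans (+-congʳ (sumUpTo-suc f k)) (+-assoc _ _ _)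

  sumUpTo-reverse : ∀ (f : ℕ → Carrier) k → sumUpTo f k ≈ sumUpTo (λ i → f (k ∸ i)) k
  sumUpTo-reverse f zero    = refl
  sumUpTo-reverse f (suc k) = begin-equality
    sumUpTo f k + f (suc k)                      ≈⟨ +-congʳ (sumUpTo-reverse f k) ⟩
    sumUpTo (λ i → f (k ∸ i)) k + f (suc k)      ≈⟨ +-comm _ _ ⟩
    f (suc k) + sumUpTo (λ i → f (k ∸ i)) k      ≈⟨ sumUpTo-suc (λ i → f (suc k ∸ i)) k ⟨
    sumUpTo (λ i → f (suc k ∸ i)) (suc k)        ∎

  mulC-cong : ∀ {f f′ g g′ : ℕ → Carrier} → (∀ j → f j ≈ f′ j) → (∀ j → g j ≈ g′ j) →
              ∀ k → mulC f g k ≈ mulC f′ g′ k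
  mulC-cong f≈f′ g≈g′ k = sumUpTo-cong k (λ i _ → *-cong (f≈f′ i) (g≈g′ (k ∸ i)))

  mulC-comm : ∀ (f g : ℕ → Carrier) k → mulC f g k ≈ mulC g f k
  mulC-comm f g k = trans (sumUpTo-reverse (λ i → f i * g (k ∸ i)) k)
    (sumUpTo-cong k (λ i i≤k →
      trans (*-comm _ _) (*-congʳ (reflexive (≡.cong g (ℕ.m∸[m∸n]≡n i≤k))))))

  mulC-distribʳ-+ : ∀ (f g h : ℕ → Carrier) k →
                    mulC (λ j → f j + g j) h k ≈ mulC f h k + mulC g h k
  mulC-distribʳ-+ f g h k =
    trans (sumUpTo-cong k (λ i _ → distribʳ (h (k ∸ i)) (f i) (g i)))
          (sumUpTo-+ (λ i → f i * h (k ∸ i)) (λ i → g i * h (k ∸ i)) k)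

  mulC-distribˡ-+ : ∀ (f g h : ℕ → Carrier) k →
                    mulC h (λ j → f j + g j) k ≈ mulC h f k + mulC h g k
  mulC-distribˡ-+ f g h k =
    trans (sumUpTo-cong k (λ i _ → distribˡ (h i) (f (k ∸ i)) (g (k ∸ i))))
          (sumUpTo-+ (λ i → h i * f (k ∸ i)) (λ i → h i * g (k ∸ i)) k)

  mulC-expand : ∀ (f g h e : ℕ → Carrier) k →
                mulC (λ j → f j + g j) (λ j → h j + e j) k ≈
                (mulC f h k + mulC f e k) + (mulC g h k + mulC g e k)
  mulC-expand f g h e k = trans (mulC-distribʳ-+ f g (λ j → h j + e j) k)
    (+-cong (mulC-distribˡ-+ h e f k) (mulC-distribˡ-+ h e g k))

  mulC-distribʳ-sumUpTo : ∀ (F : ℕ → ℕ → Carrier) h t k →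
    mulC (λ j → sumUpTo (λ i → F i j) t) h k ≈ sumUpTo (λ i → mulC (F i) h k) t
  mulC-distribʳ-sumUpTo F h zero    k = refl
  mulC-distribʳ-sumUpTo F h (suc t) k =
    trans (mulC-distribʳ-+ (λ j → sumUpTo (λ i → F i j) t) (F (suc t)) h k)
          (+-congʳ (mulC-distribʳ-sumUpTo F h t k))

  mulC-distribˡ-sumUpTo : ∀ (F : ℕ → ℕ → Carrier) h t k →
    mulC h (λ j → sumUpTo (λ i → F i j) t) k ≈ sumUpTo (λ i → mulC h (F i) k) t
  mulC-distribˡ-sumUpTo F h zero    k = refl
  mulC-distribˡ-sumUpTo F h (suc t) k =
    trans (mulC-distribˡ-+ (λ j → sumUpTo (λ i → F i j) t) (F (suc t)) h k)
          (+-congʳ (mulC-distribˡ-sumUpTo F h t k))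

  module _ {F : ℕ → ℕ → Carrier} (convex : StronglyQLogConvex F) (k : ℕ) where
    private
      P : ℕ → ℕ → Carrier
      P a b = mulC (F a) (F b) k

    shift-≤ : ∀ g a b → g +ℕ a ≤ b → P (g +ℕ a) b ≤ᵣ P a (g +ℕ b)
    shift-≤ zero    a b _     = ≤ᵣ-refl
    shift-≤ (suc g) a b g+a<b = begin
      P (suc g +ℕ a) b   ≤⟨ 0≤y-x⇒x≤y (convex (g +ℕ a) b g+a<b k) ⟩
      P (g +ℕ a) (suc b) ≤⟨ shift-≤ g a (suc b) (ℕ.m≤n⇒m≤1+n (ℕ.<⇒≤ g+a<b)) ⟩
      P a (g +ℕ suc b)   ≡⟨ ≡.cong (P a) (ℕ.+-suc g b) ⟩
      P a (suc g +ℕ b)   ∎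

    ordered-inner≤outer : ∀ {a b c d} → c ≤ a → a ≤ b → a +ℕ b ≡ c +ℕ d → P a b ≤ᵣ P c d
    ordered-inner≤outer {a} {b} {c} {d} c≤a a≤b a+b≡c+d = begin
      P a b            ≡⟨ ≡.cong (λ a → P a b) (ℕ.m∸n+n≡m c≤a) ⟨
      P (g +ℕ c) b     ≤⟨ shift-≤ g c b (≡.subst (_≤ b) (≡.sym (ℕ.m∸n+n≡m c≤a)) a≤b) ⟩
      P c (g +ℕ b)     ≡⟨ ≡.cong (P c) g+b≡d ⟩
      P c d            ∎
      where
      g : ℕ
      g = a ∸ c
      g+b≡d : g +ℕ b ≡ d
      g+b≡d = ℕ.+-cancelˡ-≡ c _ _ (≡.trans (≡.sym (ℕ.+-assoc c g b))
        (≡.trans (≡.cong (_+ℕ b) (≡.trans (ℕ.+-comm c g) (ℕ.m∸n+n≡m c≤a))) a+b≡c+d))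

    inner≤outer : ∀ {a b c d} → c ≤ a → c ≤ b → a +ℕ b ≡ c +ℕ d → P a b ≤ᵣ P c d
    inner≤outer {a} {b} {c} {d} c≤a c≤b a+b≡c+d with ℕ.≤-total a b
    ... | inj₁ a≤b = ordered-inner≤outer c≤a a≤b a+b≡c+d
    ... | inj₂ b≤a = begin
      P a b  ≈⟨ mulC-comm (F a) (F b) k ⟩
      P b a  ≤⟨ ordered-inner≤outer c≤b b≤a (≡.trans (ℕ.+-comm b a) a+b≡c+d) ⟩
      P c d  ∎

  windowSum-suc : ∀ x t a j →
                  windowSum x (suc t) a j ≈ coeff (x a) j + windowSum x t (suc a) j
  windowSum-suc x t a j = trans (sumUpTo-suc (λ i → coeff (x (a +ℕ i)) j) t)
    (+-cong (reflexive (≡.cong (λ b → coeff (x b) j) (ℕ.+-identityʳ a)))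
            (sumUpTo-cong t (λ i _ → reflexive (≡.cong (λ b → coeff (x b) j) (ℕ.+-suc a i)))))

  module _ (x : ℕ → Poly) (convex : StronglyQLogConvex (λ n → coeff (x n))) (t : ℕ) where
    private
      X W : ℕ → ℕ → Carrier
      X a = coeff (x a)
      W a = windowSum x t (suc a)

    tail*head≤head*tail : ∀ {n m} → n ≤ m → ∀ k → mulC (W n) (X m) k ≤ᵣ mulC (X n) (W m) k
    tail*head≤head*tail {n} {m} n≤m k = begin
      mulC (W n) (X m) k
        ≈⟨ mulC-distribʳ-sumUpTo (λ i → X (suc n +ℕ i)) (X m) t k ⟩
      sumUpTo (λ i → mulC (X (suc n +ℕ i)) (X m) k) t
        ≤⟨ sumUpTo-mono-≤ t (λ i _ → inner≤outer convex k
             (ℕ.m≤n⇒m≤1+n (ℕ.m≤m+n n i)) n≤m ([1+n+i]+m≡n+[1+m+i] n m i)) ⟩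
      sumUpTo (λ i → mulC (X n) (X (suc m +ℕ i)) k) t
        ≈⟨ mulC-distribˡ-sumUpTo (λ i → X (suc m +ℕ i)) (X n) t k ⟨
      mulC (X n) (W m) k ∎

    last*head≤head*last : ∀ {n m} → n ≤ m → ∀ k →
      mulC (X (suc n +ℕ suc t)) (X m) k ≤ᵣ mulC (X n) (X (suc m +ℕ suc t)) k
    last*head≤head*last {n} {m} n≤m k =
      inner≤outer convex k (ℕ.m≤n⇒m≤1+n (ℕ.m≤m+n n (suc t))) n≤m ([1+n+i]+m≡n+[1+m+i] n m (suc t))

    last*tail≤tail*last : ∀ {n m} → n ≤ m → ∀ k →
      mulC (X (suc n +ℕ suc t)) (W m) k ≤ᵣ mulC (W n) (X (suc m +ℕ suc t)) k
    last*tail≤tail*last {n} {m} n≤m k = begin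
      mulC (X N) (W m) k
        ≈⟨ mulC-distribˡ-sumUpTo (λ i → X (suc m +ℕ i)) (X N) t k ⟩
      sumUpTo (λ i → mulC (X N) (X (suc m +ℕ i)) k) t
        ≤⟨ sumUpTo-mono-≤ t (λ i i≤t → inner≤outer convex k
             (ℕ.+-monoʳ-≤ (suc n) (ℕ.m≤n⇒m≤1+n i≤t)) (ℕ.+-monoˡ-≤ i (s≤s n≤m))
             ([a+b]+[c+d]≡[a+d]+[c+b] (suc n) (suc t) (suc m) i)) ⟩
      sumUpTo (λ i → mulC (X (suc n +ℕ i)) (X M) k) t
        ≈⟨ mulC-distribʳ-sumUpTo (λ i → X (suc n +ℕ i)) (X M) t k ⟨
      mulC (W n) (X M) k ∎
      where
      N M : ℕ
      N = suc n +ℕ suc t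
      M = suc m +ℕ suc t

    windowSum-stronglyQLogConvex : StronglyQLogConvex (windowSum x (suc t))
    windowSum-stronglyQLogConvex n m n<m k = x≤y⇒0≤y-x (begin
        Q (Y (suc n)) (Y m)
      ≈⟨ mulC-cong (λ _ → refl) (windowSum-suc x t m) k ⟩
        Q (λ j → W n j + X N j) (λ j → X m j + W m j)
      ≈⟨ mulC-expand (W n) (X N) (X m) (W m) k ⟩
        (Q (W n) (X m) + Q (W n) (W m)) + (Q (X N) (X m) + Q (X N) (W m))
      ≤⟨ +-mono-≤ᵣ (+-mono-≤ᵣ (tail*head≤head*tail n≤m k) ≤ᵣ-refl)
                   (+-mono-≤ᵣ (last*head≤head*last n≤m k) (last*tail≤tail*last n≤m k)) ⟩
        (Q (X n) (W m) + Q (W n) (W m)) + (Q (X n) (X M) + Q (W n) (X M))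
      ≈⟨ interchange _ _ _ _ ⟩
        (Q (X n) (W m) + Q (X n) (X M)) + (Q (W n) (W m) + Q (W n) (X M))
      ≈⟨ mulC-expand (X n) (W n) (W m) (X M) k ⟨
        Q (λ j → X n j + W n j) (λ j → W m j + X M j)
      ≈⟨ mulC-cong {g = Y (suc m)} (windowSum-suc x t n) (λ _ → refl) k ⟨
        Q (Y n) (Y (suc m))
      ∎)
      where
      Y : ℕ → ℕ → Carrier
      Y = windowSum x (suc t)
      Q : (ℕ → Carrier) → (ℕ → Carrier) → Carrier
      Q f g = mulC f g k
      N M : ℕ
      N = suc n +ℕ suc t
      M = suc m +ℕ suc t
      n≤m : n ≤ m
      n≤m = ℕ.<⇒≤ n<m

mainTheorem4 : ∀ {c ℓ₁ ℓ₂ : Level} (R : OrderedCommutativeRing c ℓ₁ ℓ₂) (s : ℕ) → 1 ≤ s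
    → (x : ℕ → PolyDefs.Poly R)
    → PolyDefs.StronglyQLogConvex R (λ n → PolyDefs.coeff (x n))
    → PolyDefs.StronglyQLogConvex R (PolyDefs.windowSum R x s)
mainTheorem4 R (suc t) _ x convex = windowSum-stronglyQLogConvex R x convex t
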